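{- Let $H$ be a finite group with $|H|\geq 2$ and $S\subseteq H$ with $1\notin S=S^{ -1}$, such that the Cayley graph $\Gamma={\rm Cay}(H,S)$ is normal and ${\rm Aut}(H,S)=\{{\rm id}\}$. Then $D(\Gamma)=2$.
   Context: The Cayley graph ${\rm Cay}(H,S)$ has vertex set $H$, with $h$ adjacent to $sh$ for all $h\in H$, $s\in S$. $R(H)=\{x\mapsto xa : a\in H\}$ is the right regular representation, a subgroup of ${\rm Aut}(\Gamma)$. ${\rm Aut}(H,S)$ is the group of automorphisms of $H$ mapping $S$ onto $S$. $\Gamma$ is normal if $R(H)$ is normal in ${\rm Aut}(\Gamma)$, equivalently ${\rm Aut}(\Gamma)=R(H)\rtimes{\rm Aut}(H,S)$. $D(\Gamma)$ is the least $r$ such that some vertex labeling with $r$ labels is preserved by no non-identity automorphism of $\Gamma$. -}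

module Defs where

open import Data.Nat using (ℕ; _<_)
open import Data.Fin using (Fin)
open import Data.Fin.Subset using (Subset; _∈_; _∉_)
open import Data.Fin.Permutation using (Permutation′; _⟨$⟩ʳ_; _⟨$⟩ˡ_)
open import Data.Product using (Σ; ∃; _×_)
open import Relation.Nullary using (¬_)
open import Relation.Binary.PropositionalEquality using (_≡_)
open import Algebra.Structures using (IsGroup)

record FinGroup (n : ℕ) : Set where
  field
    _∙_     : Fin n → Fin n → Fin n
    ε       : Fin n
    _⁻¹     : Fin n → Fin n
    isGroup : IsGroup _≡_ _∙_ ε _⁻¹
  infixl 7 _∙_
  infix 8 _⁻¹

module _ {n : ℕ} (H : FinGroup n) (S : Subset n) where
  open FinGroup H

  Adj : Fin n → Fin n → Set
  Adj x y = Σ (Fin n) λ s → (s ∈ S) × (y ≡ s ∙ x)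

  IsGraphAut : Permutation′ n → Set
  IsGraphAut φ = ∀ x y → (Adj x y → Adj (φ ⟨$⟩ʳ x) (φ ⟨$⟩ʳ y))
                        × (Adj (φ ⟨$⟩ʳ x) (φ ⟨$⟩ʳ y) → Adj x y)

  -- Right regular representation: R_a : x ↦ x a.
  -- Normality: R(H) is normal in Aut(Γ): for every automorphism φ and a ∈ H,
  -- φ R_a φ⁻¹ = R_b for some b ∈ H.
  IsNormalCayley : Set
  IsNormalCayley = (φ : Permutation′ n) → IsGraphAut φ → (a : Fin n) →
    Σ (Fin n) λ b → ∀ x → φ ⟨$⟩ʳ ((φ ⟨$⟩ˡ x) ∙ a) ≡ x ∙ b

  IsAutHS : Permutation′ n → Set
  IsAutHS σ = (∀ x y → σ ⟨$⟩ʳ (x ∙ y) ≡ (σ ⟨$⟩ʳ x) ∙ (σ ⟨$⟩ʳ y))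
            × (∀ x → (x ∈ S → σ ⟨$⟩ʳ x ∈ S) × (σ ⟨$⟩ʳ x ∈ S → x ∈ S))

  AutHSTrivial : Set
  AutHSTrivial = (σ : Permutation′ n) → IsAutHS σ → ∀ x → σ ⟨$⟩ʳ x ≡ x

  IsDistinguishing : (r : ℕ) → (Fin n → Fin r) → Set
  IsDistinguishing r c = (φ : Permutation′ n) → IsGraphAut φ →
    (∀ x → c (φ ⟨$⟩ʳ x) ≡ c x) → ∀ x → φ ⟨$⟩ʳ x ≡ x

  HasDistinguishingLabeling : ℕ → Set
  HasDistinguishingLabeling r = ∃ λ (c : Fin n → Fin r) → IsDistinguishing r c

  DistinguishingNumberIs : ℕ → Set
  DistinguishingNumberIs r = HasDistinguishingLabeling r
                           × (∀ r′ → r′ < r → ¬ HasDistinguishingLabeling r′)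

-- An automorphism of a normal Cayley graph fixing the vertex 1 normalises R(H),
-- and evaluating φ R_a φ⁻¹ = R_b at 1 gives b = φ(a), so φ is a group automorphism;
-- it maps S, the neighbourhood of 1, onto itself. Hence the stabiliser of 1 is
-- Aut(H,S) = 1, and giving 1 its own label distinguishes Γ. A single label cannot,
-- since R_a with a ≠ 1 is a non-identity automorphism.
module Submission where

open import Defs
open import Data.Nat using (ℕ; zero; suc; _≤_; _<_; s≤s)
open import Data.Fin using (Fin; zero; suc; punchIn)
open import Data.Fin.Properties using (_≟_; punchInᵢ≢i)
open import Data.Fin.Subset using (Subset; _∈_; _∉_)
open import Data.Fin.Permutation using (Permutation′; _⟨$⟩ʳ_; _⟨$⟩ˡ_; permutation; inverseˡ)
open import Data.Product using (∃; _×_; _,_; proj₁; proj₂)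
open import Level using (0ℓ)
open import Relation.Nullary using (¬_; yes; no; contradiction)
open import Relation.Binary.PropositionalEquality
open import Algebra.Bundles using (Group)
open import Algebra.Structures using (IsGroup)
import Algebra.Properties.Group as GroupProperties

∃≢ : ∀ {n} → 2 ≤ n → (x : Fin n) → ∃ λ y → y ≢ x
∃≢ (s≤s (s≤s _)) x = punchIn x zero , punchInᵢ≢i x zero

module _ {n : ℕ} (H : FinGroup n) (S : Subset n) where
  open FinGroup H
  open IsGroup isGroup using (assoc; identityˡ; identityʳ)

  private
    group : Group 0ℓ 0ℓ
    group = record { isGroup = isGroup }

  open GroupProperties group using (//-rightDividesˡ; //-rightDividesʳ; ∙-cancelʳ)

  rightTranslation : Fin n → Permutation′ n
  rightTranslation a =
    permutation (_∙ a) (_∙ a ⁻¹) (//-rightDividesˡ a) (//-rightDividesʳ a)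

  rightTranslation-isGraphAut : ∀ a → IsGraphAut H S (rightTranslation a)
  rightTranslation-isGraphAut a x y =
      (λ { (s , s∈S , y≡sx) → s , s∈S , trans (cong (_∙ a) y≡sx) (assoc s x a) })
    , (λ { (s , s∈S , ya≡s[xa]) →
             s , s∈S , ∙-cancelʳ a y (s ∙ x) (trans ya≡s[xa] (sym (assoc s x a))) })

  ∈⇒adjε : ∀ {x} → x ∈ S → Adj H S ε x
  ∈⇒adjε {x} x∈S = x , x∈S , sym (identityʳ x)

  adjε⇒∈ : ∀ {x} → Adj H S ε x → x ∈ S
  adjε⇒∈ (s , s∈S , x≡sε) = subst (_∈ S) (sym (trans x≡sε (identityʳ s))) s∈S

  module Stabiliser (φ : Permutation′ n) (aut : IsGraphAut H S φ)
                    (φε≡ε : φ ⟨$⟩ʳ ε ≡ ε) where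

    preserves-S : ∀ x → (x ∈ S → φ ⟨$⟩ʳ x ∈ S) × (φ ⟨$⟩ʳ x ∈ S → x ∈ S)
    preserves-S x =
        (λ x∈S → adjε⇒∈ (subst (λ e → Adj H S e (φ ⟨$⟩ʳ x)) φε≡ε
                                (proj₁ (aut ε x) (∈⇒adjε x∈S))))
      , (λ φx∈S → adjε⇒∈ (proj₂ (aut ε x)
                                (subst (λ e → Adj H S e (φ ⟨$⟩ʳ x)) (sym φε≡ε) (∈⇒adjε φx∈S))))

    conjugateTranslation⇒homomorphic :
      ∀ a b → (∀ x → φ ⟨$⟩ʳ ((φ ⟨$⟩ˡ x) ∙ a) ≡ x ∙ b) →
      ∀ y → φ ⟨$⟩ʳ (y ∙ a) ≡ (φ ⟨$⟩ʳ y) ∙ (φ ⟨$⟩ʳ a)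
    conjugateTranslation⇒homomorphic a b conj y =
      trans (translated y) (cong ((φ ⟨$⟩ʳ y) ∙_) (sym φa≡b))
      where
      open ≡-Reasoning

      translated : ∀ y → φ ⟨$⟩ʳ (y ∙ a) ≡ (φ ⟨$⟩ʳ y) ∙ b
      translated y = begin
        φ ⟨$⟩ʳ (y ∙ a)                   ≡⟨ cong (λ z → φ ⟨$⟩ʳ (z ∙ a)) (sym (inverseˡ φ)) ⟩
        φ ⟨$⟩ʳ ((φ ⟨$⟩ˡ (φ ⟨$⟩ʳ y)) ∙ a) ≡⟨ conj (φ ⟨$⟩ʳ y) ⟩
        (φ ⟨$⟩ʳ y) ∙ b                   ∎

      φa≡b : φ ⟨$⟩ʳ a ≡ b
      φa≡b = begin
        φ ⟨$⟩ʳ a        ≡⟨ cong (φ ⟨$⟩ʳ_) (sym (identityˡ a)) ⟩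
        φ ⟨$⟩ʳ (ε ∙ a)  ≡⟨ translated ε ⟩
        (φ ⟨$⟩ʳ ε) ∙ b  ≡⟨ cong (_∙ b) φε≡ε ⟩
        ε ∙ b           ≡⟨ identityˡ b ⟩
        b               ∎

    normal⇒isAutHS : IsNormalCayley H S → IsAutHS H S φ
    normal⇒isAutHS normal =
        (λ x y → let b , conj = normal φ aut y
                 in conjugateTranslation⇒homomorphic y b conj x)
      , preserves-S

  normal⇒stabiliser-trivial :
    IsNormalCayley H S → AutHSTrivial H S →
    (φ : Permutation′ n) → IsGraphAut H S φ → φ ⟨$⟩ʳ ε ≡ ε → ∀ x → φ ⟨$⟩ʳ x ≡ x
  normal⇒stabiliser-trivial normal trivial φ aut φε≡ε =
    trivial φ (Stabiliser.normal⇒isAutHS φ aut φε≡ε normal)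

  markIdentity : Fin n → Fin 2
  markIdentity x with x ≟ ε
  ... | yes _ = suc zero
  ... | no  _ = zero

  markIdentity-reflects-ε : ∀ x → markIdentity x ≡ markIdentity ε → x ≡ ε
  markIdentity-reflects-ε x sameMark with x ≟ ε | ε ≟ ε
  ... | yes x≡ε | _       = x≡ε
  ... | no  _   | no ε≢ε  = contradiction refl ε≢ε
  ... | no  _   | yes _   with sameMark
  ...   | ()

  stabiliser-trivial⇒markIdentity-distinguishing :
    ((φ : Permutation′ n) → IsGraphAut H S φ → φ ⟨$⟩ʳ ε ≡ ε → ∀ x → φ ⟨$⟩ʳ x ≡ x) →
    IsDistinguishing H S 2 markIdentity
  stabiliser-trivial⇒markIdentity-distinguishing stabiliser φ aut preservesMarks =
    stabiliser φ aut (markIdentity-reflects-ε (φ ⟨$⟩ʳ ε) (preservesMarks ε))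

  ¬distinguishing₀ : ¬ HasDistinguishingLabeling H S 0
  ¬distinguishing₀ (c , _) with c ε
  ... | ()

  ¬distinguishing₁ : 2 ≤ n → ¬ HasDistinguishingLabeling H S 1
  ¬distinguishing₁ 2≤n (c , distinguishing) =
    a≢ε (trans (sym (identityˡ a))
               (distinguishing (rightTranslation a) (rightTranslation-isGraphAut a)
                               oneLabel ε))
    where
    a = proj₁ (∃≢ 2≤n ε)
    a≢ε = proj₂ (∃≢ 2≤n ε)

    oneLabel : ∀ x → c (rightTranslation a ⟨$⟩ʳ x) ≡ c x
    oneLabel x with c (rightTranslation a ⟨$⟩ʳ x) | c x
    ... | zero | zero = refl

  atLeastTwoLabels : 2 ≤ n → ∀ r → r < 2 → ¬ HasDistinguishingLabeling H S r
  atLeastTwoLabels _   zero          _ = ¬distinguishing₀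
  atLeastTwoLabels 2≤n (suc zero)    _ = ¬distinguishing₁ 2≤n
  atLeastTwoLabels _   (suc (suc _)) (s≤s (s≤s ()))

mainTheorem3 : (n : ℕ) → 2 ≤ n → (H : FinGroup n) → (S : Subset n) →
    FinGroup.ε H ∉ S →
    (∀ x → x ∈ S → FinGroup._⁻¹ H x ∈ S) →
    IsNormalCayley H S →
    AutHSTrivial H S →
    DistinguishingNumberIs H S 2
mainTheorem3 n 2≤n H S _ _ normal trivial =
    (markIdentity H S , stabiliser-trivial⇒markIdentity-distinguishing H S
                          (normal⇒stabiliser-trivial H S normal trivial))
  , atLeastTwoLabels H S 2≤n
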